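{- Let $(M,\mathcal{C},\mathcal{C}^*)$ be an orthogonally oriented matroid, $C\in\mathcal{C}$, $X\subseteq\underline{C}$, and $(C_x\mid x\in X)$ a family of elements of $\mathcal{C}$ such that $\underline{C_x}\cap X=\{x\}$ and $x\in\mathrm{sep}(C,C_x)$ for all $x\in X$. Then for every $f\in\underline{C}\setminus\bigcup_{x\in X}\mathrm{sep}(C,C_x)$ there exists $D\in\mathcal{C}$ such that $f\in\underline{D}$, $D(f)=C(f)$ and $\underline{D}\subseteq\bigl(\underline{C}\cup\bigcup_{x\in X}\underline{C_x}\bigr)\setminus X$.
   Context: Matroids are in the sense of Bruhn, Diestel, Kriesell, Pendavingh and Wollan (possibly infinite ground set); cocircuits are circuits of the dual $M^*$. A signed subset $X$ of $E$ is a support $\underline{X}\subseteq E$ with a partition $(X^+,X^-)$; $X(e)=\pm1$ according as $e\in X^\pm$; $-X$ swaps the parts. The separator is $\mathrm{sep}(X,Y)=(X^+\cap Y^-)\cup(X^-\cap Y^+)$. $X,Y$ are orthogonal if $\underline{X}\cap\underline{Y}=\emptyset$ or there are $e,f\in\underline{X}\cap\underline{Y}$ with $X(e)Y(e)=-X(f)Y(f)$. A circuit signature of $M$ is a set of signed subsets consisting of exactly two opposite signed subsets supported by each circuit of $M$; a cocircuit signature is a circuit signature of $M^*$. $(M,\mathcal{C},\mathcal{C}^*)$ is an orthogonally oriented matroid if $\mathcal{C}$ is a circuit signature, $\mathcal{C}^*$ a cocircuit signature of $M$, and every element of $\mathcal{C}$ is orthogonal to every element of $\mathcal{C}^*$.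 -}

module Defs where

open import Level using (Level; 0ℓ) renaming (suc to lsuc)
open import Data.Product using (Σ; ∃; ∃-syntax; _×_; _,_)
open import Data.Sum using (_⊎_)
open import Data.Empty using (⊥)
open import Relation.Nullary using (¬_)
open import Relation.Binary.PropositionalEquality using (_≡_)
open import Relation.Unary using (Pred; _∈_; _∉_; _⊆_; _∪_; _∩_; ∅; Empty)

Subset : Set → Set₁
Subset E = Pred E 0ℓ

_≐_ : {E : Set} → Subset E → Subset E → Set
A ≐ B = (A ⊆ B) × (B ⊆ A)

_+ₛ_ : {E : Set} → Subset E → E → Subset E
(A +ₛ x) = λ y → A y ⊎ (y ≡ x)

module _ {E : Set} (Ind : Subset E → Set) where

  IsBase : Subset E → Set₁
  IsBase B = Ind B × (∀ B′ → Ind B′ → B ⊆ B′ → B′ ⊆ B)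

  IsMinDep : Subset E → Set₁
  IsMinDep C = ¬ Ind C × (∀ D → D ⊆ C → ¬ Ind D → C ⊆ D)

-- (Possibly infinite) matroids, Bruhn–Diestel–Kriesell–Pendavingh–Wollan
-- independence axioms (I1),(I2),(I3),(IM), with ground set the type E.

record Matroid (E : Set) : Set₁ where
  field
    Ind : Subset E → Set
    I1 : Ind ∅
    I2 : ∀ {I J : Subset E} → Ind J → I ⊆ J → Ind I
    I3 : ∀ {I I′ : Subset E} → Ind I → ¬ IsBase Ind I → IsBase Ind I′ →
         ∃[ x ] (x ∈ I′ × x ∉ I × Ind (I +ₛ x))
    IM : ∀ {I X : Subset E} → Ind I → I ⊆ X →
         Σ (Subset E) λ B → I ⊆ B × B ⊆ X × Ind B ×
           (∀ B′ → Ind B′ → B ⊆ B′ → B′ ⊆ X → B′ ⊆ B)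

  Base : Subset E → Set₁
  Base = IsBase Ind

  Circuit : Subset E → Set₁
  Circuit = IsMinDep Ind

  -- independent sets of the dual M* : subsets of the complement of a base
  CoInd : Subset E → Set₁
  CoInd I = Σ (Subset E) λ B → Base B × (∀ e → e ∈ I → e ∉ B)

  Cocircuit : Subset E → Set₁
  Cocircuit C = ¬ CoInd C × (∀ D → D ⊆ C → ¬ CoInd D → C ⊆ D)

open Matroid public

record SignedSubset (E : Set) : Set₁ where
  constructor signed
  field
    pos : Subset E
    neg : Subset E
    disjoint : ∀ e → e ∈ pos → e ∈ neg → ⊥

open SignedSubset public

module _ {E : Set} where

  supp : SignedSubset E → Subset E
  supp X = pos X ∪ neg X

  opp : SignedSubset E → SignedSubset E
  opp X = signed (neg X) (pos X) (λ e n p → disjoint X e p n)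

  _≐ₛ_ : SignedSubset E → SignedSubset E → Set
  X ≐ₛ Y = (pos X ≐ pos Y) × (neg X ≐ neg Y)

  -- X(e) = Y(e)   (for e in both supports)
  SameSign : SignedSubset E → SignedSubset E → E → Set
  SameSign X Y e = (e ∈ pos X → e ∈ pos Y) × (e ∈ neg X → e ∈ neg Y)

  sep : SignedSubset E → SignedSubset E → Subset E
  sep X Y = (pos X ∩ neg Y) ∪ (neg X ∩ pos Y)

  agree : SignedSubset E → SignedSubset E → Subset E
  agree X Y = (pos X ∩ pos Y) ∪ (neg X ∩ neg Y)

  -- orthogonality: disjoint supports, or e,f in both supports with
  -- X(e)Y(e) = −X(f)Y(f)  (i.e. one in sep, one in agree)
  Orthogonal : SignedSubset E → SignedSubset E → Set
  Orthogonal X Y =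
    (∀ e → e ∈ supp X → e ∈ supp Y → ⊥)
    ⊎ ((∃[ e ] e ∈ sep X Y) × (∃[ f ] f ∈ agree X Y))

  IsSignatureOf : (Subset E → Set₁) → (SignedSubset E → Set) → Set₁
  IsSignatureOf F 𝒮 =
    (∀ X → 𝒮 X → F (supp X))
    × (∀ C → F C → Σ (SignedSubset E) λ X → 𝒮 X × supp X ≐ C
                   × (∃[ Y ] (𝒮 Y × Y ≐ₛ opp X))
                   × (∀ Y → 𝒮 Y → supp Y ≐ C → (Y ≐ₛ X) ⊎ (Y ≐ₛ opp X)))

  CircuitSignature : Matroid E → (SignedSubset E → Set) → Set₁
  CircuitSignature M = IsSignatureOf (Circuit M)

  CocircuitSignature : Matroid E → (SignedSubset E → Set) → Set₁
  CocircuitSignature M = IsSignatureOf (Cocircuit M)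

  record OrthOriented (M : Matroid E) (𝒞 𝒞* : SignedSubset E → Set) : Set₁ where
    field
      circSig   : CircuitSignature M 𝒞
      cocircSig : CocircuitSignature M 𝒞*
      orth      : ∀ C D → 𝒞 C → 𝒞* D → Orthogonal C D

-- Let Y = (C ∪ ⋃ Cₓ) ∖ X and let B₀ be a maximal independent subset of Y − f.
-- If B₀ + f is dependent, the fundamental circuit of f over B₀ lies in Y and,
-- suitably signed, is the required D. Otherwise extend B₀ + f to a base B; the
-- fundamental cocircuit K of f with respect to B meets Y only in f. Then
-- supp C ∩ supp K ⊆ X ∪ {f}, and orthogonality of each Cₓ with K forces the
-- sign product C(e)K(e) to take the same value at every x ∈ X as at f, so C
-- and K cannot be orthogonal.
module Submission where

open import Defs
import Level
open import Level using (0ℓ)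
open import Axiom.ExcludedMiddle using (ExcludedMiddle)
open import Axiom.DoubleNegationElimination using (em⇒dne)
open import Data.Product using (Σ; _×_; _,_; proj₁; proj₂)
open import Data.Sum using (_⊎_; inj₁; inj₂)
open import Data.Empty using (⊥; ⊥-elim)
open import Data.Unit using (⊤; tt)
open import Data.Sign using (Sign; +; -; opposite; _*_)
open import Data.Sign.Properties using (s*s≡+; *-assoc; opposite-involutive; s≢opposite[s])
open import Function using (_∘_)
open import Relation.Nullary using (¬_; yes; no)
open import Relation.Binary.PropositionalEquality
  using (_≡_; _≢_; refl; sym; trans; cong; cong₂; subst; module ≡-Reasoning)
open import Relation.Unary using (_∈_; _∉_; _⊆_)

*-cancel-middle : ∀ s t u → (s * t) * (t * u) ≡ s * u
*-cancel-middle s t u = begin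
  (s * t) * (t * u)   ≡⟨ *-assoc s t (t * u) ⟩
  s * (t * (t * u))   ≡⟨ cong (s *_) (sym (*-assoc t t u)) ⟩
  s * ((t * t) * u)   ≡⟨ cong (λ v → s * (v * u)) (s*s≡+ t) ⟩
  s * u               ∎
  where open ≡-Reasoning

module _ {E : Set} where

  sign : (A : SignedSubset E) {e : E} → e ∈ supp A → Sign
  sign A (inj₁ _) = +
  sign A (inj₂ _) = -

  sign-irrelevant : (A : SignedSubset E) {e : E} (a a′ : e ∈ supp A) → sign A a ≡ sign A a′
  sign-irrelevant A (inj₁ _) (inj₁ _) = refl
  sign-irrelevant A (inj₁ p) (inj₂ n) = ⊥-elim (disjoint A _ p n)
  sign-irrelevant A (inj₂ n) (inj₁ p) = ⊥-elim (disjoint A _ p n)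
  sign-irrelevant A (inj₂ _) (inj₂ _) = refl

  signProduct : (A B : SignedSubset E) {e : E} → e ∈ supp A → e ∈ supp B → Sign
  signProduct A B a b = sign A a * sign B b

  signProduct-irrelevant : (A B : SignedSubset E) {e : E} (a a′ : e ∈ supp A) (b b′ : e ∈ supp B) →
                           signProduct A B a b ≡ signProduct A B a′ b′
  signProduct-irrelevant A B a a′ b b′ = cong₂ _*_ (sign-irrelevant A a a′) (sign-irrelevant B b b′)

  signProduct-via : (A B D : SignedSubset E) {e : E} (a : e ∈ supp A) (b : e ∈ supp B) (d : e ∈ supp D) →
                    signProduct A D a d ≡ signProduct A B a b * signProduct B D b d
  signProduct-via A B D a b d = sym (*-cancel-middle (sign A a) (sign B b) (sign D d))

  sep⊆supp : (A B : SignedSubset E) {e : E} → e ∈ sep A B → e ∈ supp A × e ∈ supp B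
  sep⊆supp A B (inj₁ (p , n)) = inj₁ p , inj₂ n
  sep⊆supp A B (inj₂ (n , p)) = inj₂ n , inj₁ p

  agree⊆supp : (A B : SignedSubset E) {e : E} → e ∈ agree A B → e ∈ supp A × e ∈ supp B
  agree⊆supp A B (inj₁ (p , q)) = inj₁ p , inj₁ q
  agree⊆supp A B (inj₂ (n , m)) = inj₂ n , inj₂ m

  sep∩agree-empty : (A B : SignedSubset E) {e : E} → e ∈ sep A B → e ∉ agree A B
  sep∩agree-empty A B (inj₁ (p , _)) (inj₂ (n , _)) = disjoint A _ p n
  sep∩agree-empty A B (inj₁ (_ , n)) (inj₁ (_ , p)) = disjoint B _ p n
  sep∩agree-empty A B (inj₂ (n , _)) (inj₁ (p , _)) = disjoint A _ p n
  sep∩agree-empty A B (inj₂ (_ , p)) (inj₂ (_ , n)) = disjoint B _ p n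

  sep⇒signProduct≡- : (A B : SignedSubset E) {e : E} → e ∈ sep A B →
                      (a : e ∈ supp A) (b : e ∈ supp B) → signProduct A B a b ≡ -
  sep⇒signProduct≡- A B (inj₁ (p , n)) a b = signProduct-irrelevant A B a (inj₁ p) b (inj₂ n)
  sep⇒signProduct≡- A B (inj₂ (n , p)) a b = signProduct-irrelevant A B a (inj₂ n) b (inj₁ p)

  agree⇒signProduct≡+ : (A B : SignedSubset E) {e : E} → e ∈ agree A B →
                        (a : e ∈ supp A) (b : e ∈ supp B) → signProduct A B a b ≡ +
  agree⇒signProduct≡+ A B (inj₁ (p , q)) a b = signProduct-irrelevant A B a (inj₁ p) b (inj₁ q)
  agree⇒signProduct≡+ A B (inj₂ (n , m)) a b = signProduct-irrelevant A B a (inj₂ n) b (inj₂ m)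

  ∉sep⇒signProduct≡+ : (A B : SignedSubset E) {e : E} → e ∉ sep A B →
                       (a : e ∈ supp A) (b : e ∈ supp B) → signProduct A B a b ≡ +
  ∉sep⇒signProduct≡+ A B _   (inj₁ _) (inj₁ _) = refl
  ∉sep⇒signProduct≡+ A B _   (inj₂ _) (inj₂ _) = refl
  ∉sep⇒signProduct≡+ A B e∉ (inj₁ p) (inj₂ n) = ⊥-elim (e∉ (inj₁ (p , n)))
  ∉sep⇒signProduct≡+ A B e∉ (inj₂ n) (inj₁ p) = ⊥-elim (e∉ (inj₂ (n , p)))

  Orthogonal⇒¬constant : (A B : SignedSubset E) {e : E} → Orthogonal A B →
                         e ∈ supp A → e ∈ supp B → (s : Sign) →
                         ¬ (∀ {e′} (a : e′ ∈ supp A) (b : e′ ∈ supp B) → signProduct A B a b ≡ s)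
  Orthogonal⇒¬constant A B (inj₁ disjoint-supports) a b _ _ = disjoint-supports _ a b
  Orthogonal⇒¬constant A B (inj₂ ((_ , e∈sep) , (_ , e′∈agree))) _ _ s constant =
    let a  , b  = sep⊆supp A B e∈sep
        a′ , b′ = agree⊆supp A B e′∈agree
    in s≢opposite[s] - (begin
      -                        ≡⟨ sym (sep⇒signProduct≡- A B e∈sep a b) ⟩
      signProduct A B a b      ≡⟨ constant a b ⟩
      s                        ≡⟨ sym (constant a′ b′) ⟩
      signProduct A B a′ b′    ≡⟨ agree⇒signProduct≡+ A B e′∈agree a′ b′ ⟩
      +                        ∎)
    where open ≡-Reasoning

  Orthogonal⇒opposite-signs : (A B : SignedSubset E) {u v : E} → Orthogonal A B →
    (∀ {k} → k ∈ supp A → k ∈ supp B → k ≡ u ⊎ k ≡ v) →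
    (a : u ∈ supp A) (b : u ∈ supp B) →
    Σ (v ∈ supp A) λ a′ → Σ (v ∈ supp B) λ b′ → signProduct A B a b ≡ opposite (signProduct A B a′ b′)
  Orthogonal⇒opposite-signs A B (inj₁ disjoint-supports) _ a b = ⊥-elim (disjoint-supports _ a b)
  Orthogonal⇒opposite-signs A B (inj₂ ((e , e∈sep) , (e′ , e′∈agree))) meet a b
    with meet (proj₁ (sep⊆supp A B e∈sep)) (proj₂ (sep⊆supp A B e∈sep))
       | meet (proj₁ (agree⊆supp A B e′∈agree)) (proj₂ (agree⊆supp A B e′∈agree))
  ... | inj₁ refl | inj₁ refl = ⊥-elim (sep∩agree-empty A B e∈sep e′∈agree)
  ... | inj₂ refl | inj₂ refl = ⊥-elim (sep∩agree-empty A B e∈sep e′∈agree)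
  ... | inj₁ refl | inj₂ refl =
    let a′ , b′ = agree⊆supp A B e′∈agree
    in a′ , b′ , trans (sep⇒signProduct≡- A B e∈sep a b)
                       (cong opposite (sym (agree⇒signProduct≡+ A B e′∈agree a′ b′)))
  ... | inj₂ refl | inj₁ refl =
    let a′ , b′ = sep⊆supp A B e∈sep
    in a′ , b′ , trans (agree⇒signProduct≡+ A B e′∈agree a b)
                       (cong opposite (sym (sep⇒signProduct≡- A B e∈sep a′ b′)))

  sameSign⁺ : (A B : SignedSubset E) {e : E} → e ∈ pos A → e ∈ pos B → SameSign A B e
  sameSign⁺ A B a⁺ b⁺ = (λ _ → b⁺) , (λ a⁻ → ⊥-elim (disjoint A _ a⁺ a⁻))

  sameSign⁻ : (A B : SignedSubset E) {e : E} → e ∈ neg A → e ∈ neg B → SameSign A B e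
  sameSign⁻ A B a⁻ b⁻ = (λ a⁺ → ⊥-elim (disjoint A _ a⁺ a⁻)) , (λ _ → b⁻)

  ≐ₛopp⇒supp⊆ : (A B : SignedSubset E) → A ≐ₛ opp B → supp A ⊆ supp B
  ≐ₛopp⇒supp⊆ A B ((A⁺⊆B⁻ , _) , _) (inj₁ a⁺) = inj₂ (A⁺⊆B⁻ a⁺)
  ≐ₛopp⇒supp⊆ A B (_ , (A⁻⊆B⁺ , _)) (inj₂ a⁻) = inj₁ (A⁻⊆B⁺ a⁻)

module _ {E : Set} {F : Subset E → Set₁} {𝒮 : SignedSubset E → Set} (signature : IsSignatureOf F 𝒮) where

  signedSupport : {D : Subset E} → F D → Σ (SignedSubset E) λ S → 𝒮 S × supp S ≐ D
  signedSupport F-D with proj₂ signature _ F-D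
  ... | S , S∈𝒮 , S≐D , _ = S , S∈𝒮 , S≐D

  signedSupport-matching : {D : Subset E} {f : E} → F D → f ∈ D → (A : SignedSubset E) → f ∈ supp A →
    Σ (SignedSubset E) λ S → 𝒮 S × supp S ⊆ D × f ∈ supp S × SameSign A S f
  signedSupport-matching {D} {f} F-D f∈D A f∈A with proj₂ signature _ F-D
  ... | S , S∈𝒮 , (S⊆D , D⊆S) , (S′ , S′∈𝒮 , S′≐-S) , _ = choose f∈A (D⊆S f∈D)
    where
    S′⊆D : supp S′ ⊆ D
    S′⊆D = S⊆D ∘ ≐ₛopp⇒supp⊆ S′ S S′≐-S

    choose : f ∈ supp A → f ∈ supp S → Σ (SignedSubset E) λ S → 𝒮 S × supp S ⊆ D × f ∈ supp S × SameSign A S f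
    choose (inj₁ a⁺) (inj₁ s⁺) = S , S∈𝒮 , S⊆D , inj₁ s⁺ , sameSign⁺ A S a⁺ s⁺
    choose (inj₂ a⁻) (inj₂ s⁻) = S , S∈𝒮 , S⊆D , inj₂ s⁻ , sameSign⁻ A S a⁻ s⁻
    choose (inj₁ a⁺) (inj₂ s⁻) =
      let s′⁺ = proj₂ (proj₁ S′≐-S) s⁻ in S′ , S′∈𝒮 , S′⊆D , inj₁ s′⁺ , sameSign⁺ A S′ a⁺ s′⁺
    choose (inj₂ a⁻) (inj₁ s⁺) =
      let s′⁻ = proj₂ (proj₂ S′≐-S) s⁺ in S′ , S′∈𝒮 , S′⊆D , inj₂ s′⁻ , sameSign⁻ A S′ a⁻ s′⁻

_-ₛ_ : {E : Set} → Subset E → E → Subset E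
A -ₛ x = λ y → y ∈ A × y ≢ x

module _ {E : Set} where

  +ₛ-mono : {A B : Subset E} {x : E} → A ⊆ B → (A +ₛ x) ⊆ (B +ₛ x)
  +ₛ-mono A⊆B (inj₁ a) = inj₁ (A⊆B a)
  +ₛ-mono A⊆B (inj₂ y≡x) = inj₂ y≡x

  -ₛ-mono : {A B : Subset E} {x : E} → A ⊆ B → (A -ₛ x) ⊆ (B -ₛ x)
  -ₛ-mono A⊆B (a , y≢x) = A⊆B a , y≢x

module _ {E : Set} (M : Matroid E) where

  record MaximalIndependentIn (S J : Subset E) : Set₁ where
    field
      independent : Ind M J
      within      : J ⊆ S
      maximal     : ∀ J′ → Ind M J′ → J ⊆ J′ → J′ ⊆ S → J′ ⊆ J

  open MaximalIndependentIn public

  maximalIndependentExtension : {I S : Subset E} → Ind M I → I ⊆ S →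
                                Σ (Subset E) λ J → I ⊆ J × MaximalIndependentIn S J
  maximalIndependentExtension I-ind I⊆S with IM M I-ind I⊆S
  ... | J , I⊆J , J⊆S , J-ind , J-max =
    J , I⊆J , record { independent = J-ind ; within = J⊆S ; maximal = J-max }

  extendToBase : {I : Subset E} → Ind M I → Σ (Subset E) λ B → I ⊆ B × Base M B
  extendToBase I-ind with maximalIndependentExtension {S = λ _ → ⊤} I-ind (λ _ → tt)
  ... | B , I⊆B , B-max =
    B , I⊆B , independent B-max , λ B′ B′-ind B⊆B′ → maximal B-max B′ B′-ind B⊆B′ (λ _ → tt)

  Ind-remove : {B : Subset E} (b : E) → Ind M B → Ind M (B -ₛ b)
  Ind-remove b B-ind = I2 M B-ind proj₁

  Base⇒¬Base-remove : {B : Subset E} (b : E) → Base M B → b ∈ B → ¬ Base M (B -ₛ b)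
  Base⇒¬Base-remove b (B-ind , _) b∈B (_ , B-b-max) = proj₂ (B-b-max _ B-ind proj₁ b∈B) refl

  FundamentalCircuit : Subset E → E → Subset E
  FundamentalCircuit I f e = e ≡ f ⊎ (e ∈ I × Ind M ((I -ₛ e) +ₛ f))

  FundamentalCocircuit : Subset E → E → Subset E
  FundamentalCocircuit B f e = e ≡ f ⊎ (e ∉ B × Ind M ((B -ₛ f) +ₛ e))

  fundamentalCircuit⊆+ₛ : {I : Subset E} {f : E} → FundamentalCircuit I f ⊆ (I +ₛ f)
  fundamentalCircuit⊆+ₛ (inj₁ e≡f) = inj₂ e≡f
  fundamentalCircuit⊆+ₛ (inj₂ (e∈I , _)) = inj₁ e∈I

module _ (em : ExcludedMiddle 0ℓ) {E : Set} (M : Matroid E) where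

  ∉-remove⇒≡ : (B : Subset E) {x b : E} → x ∈ B → x ∉ (B -ₛ b) → x ≡ b
  ∉-remove⇒≡ B x∈B x∉B-b = em⇒dne em λ x≢b → x∉B-b (x∈B , x≢b)

  fundamentalCircuit-minimal : {I : Subset E} {f : E} → Ind M I →
    ∀ D′ → D′ ⊆ FundamentalCircuit M I f → ¬ Ind M D′ → FundamentalCircuit M I f ⊆ D′
  fundamentalCircuit-minimal {I} {f} I-ind D′ D′⊆D D′-dep {e} e∈D =
    em⇒dne em λ e∉D′ → D′-dep (I2 M (independent-superset e∈D) (D′-avoids e∉D′ e∈D))
    where
    Avoiding : e ∈ FundamentalCircuit M I f → Subset E
    Avoiding (inj₁ _) = I
    Avoiding (inj₂ _) = (I -ₛ e) +ₛ f

    independent-superset : (e∈D : e ∈ FundamentalCircuit M I f) → Ind M (Avoiding e∈D)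
    independent-superset (inj₁ _) = I-ind
    independent-superset (inj₂ (_ , I-e+f-ind)) = I-e+f-ind

    D′-avoids : e ∉ D′ → (e∈D : e ∈ FundamentalCircuit M I f) → D′ ⊆ Avoiding e∈D
    D′-avoids e∉D′ (inj₁ refl) d∈D′ with D′⊆D d∈D′
    ... | inj₁ refl = ⊥-elim (e∉D′ d∈D′)
    ... | inj₂ (d∈I , _) = d∈I
    D′-avoids e∉D′ (inj₂ _) d∈D′ with D′⊆D d∈D′
    ... | inj₁ d≡f = inj₂ d≡f
    ... | inj₂ (d∈I , _) = inj₁ (d∈I , λ { refl → e∉D′ d∈D′ })

  module _ (em₁ : ExcludedMiddle (Level.suc 0ℓ)) where

    maximalIndependentIn⊇Base⇒Base : {B S J : Subset E} → Base M B → B ⊆ S →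
                                     MaximalIndependentIn M S J → Base M J
    maximalIndependentIn⊇Base⇒Base {B} {S} {J} B-base B⊆S J-max with em₁ {Base M J}
    ... | yes J-base = J-base
    ... | no J-nonbase with I3 M (independent J-max) J-nonbase B-base
    ... | x , x∈B , x∉J , J+x-ind = ⊥-elim (x∉J (maximal J-max (J +ₛ x) J+x-ind inj₁ J+x⊆S (inj₂ refl)))
      where
      J+x⊆S : (J +ₛ x) ⊆ S
      J+x⊆S (inj₁ y∈J) = within J-max y∈J
      J+x⊆S (inj₂ refl) = B⊆S x∈B

    exchangeBase : {B : Subset E} {b e : E} → Base M B → e ∉ B →
                   Ind M ((B -ₛ b) +ₛ e) → Base M ((B -ₛ b) +ₛ e)
    exchangeBase {B} {b} {e} B-base e∉B B′-ind with em₁ {Base M ((B -ₛ b) +ₛ e)}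
    ... | yes B′-base = B′-base
    ... | no B′-nonbase with I3 M B′-ind B′-nonbase B-base
    ... | y , y∈B , y∉B′ , B′+y-ind = ⊥-elim (e∉B (proj₂ B-base (B +ₛ e) (I2 M B′+y-ind B+e⊆B′+y) inj₁ (inj₂ refl)))
      where
      y≡b : y ≡ b
      y≡b = ∉-remove⇒≡ B y∈B (y∉B′ ∘ inj₁)

      B+e⊆B′+y : (B +ₛ e) ⊆ (((B -ₛ b) +ₛ e) +ₛ y)
      B+e⊆B′+y {c} (inj₁ c∈B) with em {c ≡ b}
      ... | yes c≡b = inj₂ (trans c≡b (sym y≡b))
      ... | no c≢b = inj₁ (inj₁ (c∈B , c≢b))
      B+e⊆B′+y (inj₂ c≡e) = inj₁ (inj₂ c≡e)

    -- If D were independent, extend it to a base J inside B + f for a base B ⊇ I.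
    -- Exchanging any b ∈ I ∖ J out of B brings in f, so b ∈ D ⊆ J; hence I + f ⊆ J.
    fundamentalCircuit-dependent : {I : Subset E} {f : E} → Ind M I → ¬ Ind M (I +ₛ f) →
                                   ¬ Ind M (FundamentalCircuit M I f)
    fundamentalCircuit-dependent {I} {f} I-ind I+f-dep D-ind with extendToBase M I-ind
    ... | B , I⊆B , B-base
        with maximalIndependentExtension M {S = B +ₛ f} D-ind (λ e∈D → +ₛ-mono {A = I} {B = B} I⊆B (fundamentalCircuit⊆+ₛ M {I} {f} e∈D))
    ... | J , D⊆J , J-max = I+f-dep (I2 M (independent J-max) I+f⊆J)
      where
      J-base : Base M J
      J-base = maximalIndependentIn⊇Base⇒Base {S = B +ₛ f} B-base inj₁ J-max

      I∖J-exchanges : {b : E} → b ∈ I → b ∉ J → ⊥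
      I∖J-exchanges {b} b∈I b∉J
        with I3 M (Ind-remove M b (proj₁ B-base)) (Base⇒¬Base-remove M b B-base (I⊆B b∈I)) J-base
      ... | x , x∈J , x∉B-b , B-b+x-ind with within J-max x∈J
      ... | inj₁ x∈B = b∉J (subst J (∉-remove⇒≡ B x∈B x∉B-b) x∈J)
      ... | inj₂ refl = b∉J (D⊆J {b} (inj₂ (b∈I , I2 M B-b+x-ind (+ₛ-mono {A = I -ₛ b} {B = B -ₛ b} (-ₛ-mono {A = I} {B = B} I⊆B)))))

      I+f⊆J : (I +ₛ f) ⊆ J
      I+f⊆J (inj₁ b∈I) = em⇒dne em (I∖J-exchanges b∈I)
      I+f⊆J (inj₂ refl) = D⊆J (inj₁ refl)

    fundamentalCircuit-circuit : {I : Subset E} {f : E} → Ind M I → ¬ Ind M (I +ₛ f) →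
                                 Circuit M (FundamentalCircuit M I f)
    fundamentalCircuit-circuit I-ind I+f-dep =
      fundamentalCircuit-dependent I-ind I+f-dep , fundamentalCircuit-minimal I-ind

    fundamentalCocircuit-¬CoInd : {B : Subset E} {f : E} → Base M B → f ∈ B →
                                  ¬ CoInd M (FundamentalCocircuit M B f)
    fundamentalCocircuit-¬CoInd {B} {f} B-base f∈B (B′ , B′-base , K∩B′-empty)
      with I3 M (Ind-remove M f (proj₁ B-base)) (Base⇒¬Base-remove M f B-base f∈B) B′-base
    ... | x , x∈B′ , x∉B-f , B-f+x-ind = K∩B′-empty x (inj₂ (x∉B , B-f+x-ind)) x∈B′
      where
      x∉B : x ∉ B
      x∉B x∈B = K∩B′-empty x (inj₁ (∉-remove⇒≡ B x∈B x∉B-f)) x∈B′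

    fundamentalCocircuit-minimal : {B : Subset E} {f : E} → Base M B →
      ∀ D → D ⊆ FundamentalCocircuit M B f → ¬ CoInd M D → FundamentalCocircuit M B f ⊆ D
    fundamentalCocircuit-minimal {B} {f} B-base D D⊆K D-dep {e} e∈K =
      em⇒dne em λ e∉D → D-dep (coindependent e∉D e∈K)
      where
      coindependent : e ∉ D → e ∈ FundamentalCocircuit M B f → CoInd M D
      coindependent e∉D (inj₁ refl) = B , B-base , D∩B-empty
        where
        D∩B-empty : ∀ d → d ∈ D → d ∉ B
        D∩B-empty d d∈D d∈B with D⊆K d∈D
        ... | inj₁ refl = e∉D d∈D
        ... | inj₂ (d∉B , _) = d∉B d∈B
      coindependent e∉D (inj₂ (e∉B , B-f+e-ind)) = _ , exchangeBase B-base e∉B B-f+e-ind , D∩B′-empty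
        where
        D∩B′-empty : ∀ d → d ∈ D → d ∉ ((B -ₛ f) +ₛ e)
        D∩B′-empty d d∈D (inj₂ refl) = e∉D d∈D
        D∩B′-empty d d∈D (inj₁ (d∈B , d≢f)) with D⊆K d∈D
        ... | inj₁ d≡f = d≢f d≡f
        ... | inj₂ (d∉B , _) = d∉B d∈B

    fundamentalCocircuit-cocircuit : {B : Subset E} {f : E} → Base M B → f ∈ B →
                                     Cocircuit M (FundamentalCocircuit M B f)
    fundamentalCocircuit-cocircuit B-base f∈B =
      fundamentalCocircuit-¬CoInd B-base f∈B , fundamentalCocircuit-minimal B-base

  fundamentalCocircuit∩⊆ : {S B₀ B : Subset E} {f e : E} → MaximalIndependentIn M (S -ₛ f) B₀ →
    (B₀ +ₛ f) ⊆ B → e ∈ FundamentalCocircuit M B f → e ∈ S → e ≡ f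
  fundamentalCocircuit∩⊆ _ _ (inj₁ e≡f) _ = e≡f
  fundamentalCocircuit∩⊆ {S} {B₀} {B} {f} {e} B₀-max B₀+f⊆B (inj₂ (e∉B , B-f+e-ind)) e∈S =
    em⇒dne em λ e≢f → e∉B (B₀+f⊆B (inj₁ (maximal B₀-max (B₀ +ₛ e) (B₀+e-ind) inj₁ (B₀+e⊆S-f e≢f) (inj₂ refl))))
    where
    B₀+e-ind : Ind M (B₀ +ₛ e)
    B₀+e-ind = I2 M B-f+e-ind (+ₛ-mono {A = B₀} {B = B -ₛ f} λ b∈B₀ → B₀+f⊆B (inj₁ b∈B₀) , proj₂ (within B₀-max b∈B₀))

    B₀+e⊆S-f : e ≢ f → (B₀ +ₛ e) ⊆ (S -ₛ f)
    B₀+e⊆S-f _   (inj₁ b∈B₀) = within B₀-max b∈B₀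
    B₀+e⊆S-f e≢f (inj₂ refl) = e∈S , e≢f

Allowed : {E : Set} (C : SignedSubset E) (X : Subset E) (Cx : (x : E) → x ∈ X → SignedSubset E) → Subset E
Allowed {E} C X Cx e = (e ∈ supp C ⊎ Σ E λ x → Σ (x ∈ X) λ p → e ∈ supp (Cx x p)) × e ∉ X

module _ (em : ExcludedMiddle 0ℓ) {E : Set} (C : SignedSubset E) (X : Subset E)
  (Cx : (x : E) → x ∈ X → SignedSubset E)
  (x∈Cx : ∀ x (p : x ∈ X) → x ∈ supp (Cx x p))
  (Cx∩X⊆x : ∀ x (p : x ∈ X) y → y ∈ supp (Cx x p) → y ∈ X → y ≡ x)
  (x∈sep : ∀ x (p : x ∈ X) → x ∈ sep C (Cx x p))
  {f : E} (f∈C : f ∈ supp C) (f∉sep : ∀ x (p : x ∈ X) → f ∉ sep C (Cx x p))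
  (K : SignedSubset E) (f∈K : f ∈ supp K)
  (K∩Allowed⊆f : ∀ {e} → e ∈ supp K → e ∈ Allowed C X Cx → e ≡ f)
  (Cx⊥K : ∀ x (p : x ∈ X) → Orthogonal (Cx x p) K) where

  -- Cₓ meets K at most in x and f, so by orthogonality Cₓ(x)K(x) = −Cₓ(f)K(f);
  -- with C(x)Cₓ(x) = − and C(f)Cₓ(f) = + the two sign flips cancel.
  signProduct-at-X : ∀ x (p : x ∈ X) (c : x ∈ supp C) (k : x ∈ supp K) →
                     signProduct C K c k ≡ signProduct C K f∈C f∈K
  signProduct-at-X x p c k with Orthogonal⇒opposite-signs A K (Cx⊥K x p) meet (x∈Cx x p) k
    where
    A : SignedSubset E
    A = Cx x p

    meet : ∀ {k′} → k′ ∈ supp A → k′ ∈ supp K → k′ ≡ x ⊎ k′ ≡ f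
    meet {k′} a k with em {k′ ∈ X}
    ... | yes k′∈X = inj₁ (Cx∩X⊆x x p k′ a k′∈X)
    ... | no k′∉X = inj₂ (K∩Allowed⊆f k (inj₂ (x , p , a) , k′∉X))
  ... | f∈A , f∈K′ , flipped = begin
    signProduct C K c k                                           ≡⟨ signProduct-via C A K c a k ⟩
    signProduct C A c a * signProduct A K a k                     ≡⟨ cong₂ _*_ (sep⇒signProduct≡- C A (x∈sep x p) c a) flipped ⟩
    opposite (opposite (signProduct A K f∈A f∈K′))                ≡⟨ opposite-involutive _ ⟩
    signProduct A K f∈A f∈K′                                      ≡⟨ cong (_* signProduct A K f∈A f∈K′) (sym (∉sep⇒signProduct≡+ C A (f∉sep x p) f∈C f∈A)) ⟩
    signProduct C A f∈C f∈A * signProduct A K f∈A f∈K′            ≡⟨ sym (signProduct-via C A K f∈C f∈A f∈K′) ⟩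
    signProduct C K f∈C f∈K′                                      ≡⟨ signProduct-irrelevant C K f∈C f∈C f∈K′ f∈K ⟩
    signProduct C K f∈C f∈K                                       ∎
    where
    open ≡-Reasoning

    A : SignedSubset E
    A = Cx x p

    a : x ∈ supp A
    a = x∈Cx x p

  signProduct-constant : ∀ {e} (c : e ∈ supp C) (k : e ∈ supp K) → signProduct C K c k ≡ signProduct C K f∈C f∈K
  signProduct-constant {e} c k with em {e ∈ X}
  ... | yes e∈X = signProduct-at-X e e∈X c k
  ... | no e∉X with K∩Allowed⊆f k (inj₁ c , e∉X)
  ...   | refl = signProduct-irrelevant C K c f∈C k f∈K

  ¬Orthogonal-C-K : ¬ Orthogonal C K
  ¬Orthogonal-C-K C⊥K = Orthogonal⇒¬constant C K C⊥K f∈C f∈K _ signProduct-constant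

proposition4p17 : ExcludedMiddle 0ℓ → ExcludedMiddle (Level.suc 0ℓ) →
    {E : Set} (M : Matroid E) (𝒞 𝒞* : SignedSubset E → Set) →
    OrthOriented M 𝒞 𝒞* →
    (C : SignedSubset E) → 𝒞 C →
    (X : Subset E) → X ⊆ supp C →
    (Cx : (x : E) → x ∈ X → SignedSubset E) →
    (∀ x (p : x ∈ X) → 𝒞 (Cx x p)) →
    (∀ x (p : x ∈ X) → x ∈ supp (Cx x p)) →
    (∀ x (p : x ∈ X) y → y ∈ supp (Cx x p) → y ∈ X → y ≡ x) →
    (∀ x (p : x ∈ X) → x ∈ sep C (Cx x p)) →
    (f : E) → f ∈ supp C →
    (∀ x (p : x ∈ X) → f ∉ sep C (Cx x p)) →
    Σ (SignedSubset E) λ D → 𝒞 D × f ∈ supp D × SameSign C D f ×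
    (∀ e → e ∈ supp D →
    (e ∈ supp C ⊎ Σ E λ x → Σ (x ∈ X) λ p → e ∈ supp (Cx x p)) × e ∉ X)
proposition4p17 em em₁ M 𝒞 𝒞* oo C C∈𝒞 X _ Cx Cx∈𝒞 x∈Cx Cx∩X⊆x x∈sep f f∈C f∉sep
  with maximalIndependentExtension M {S = Allowed C X Cx -ₛ f} (I1 M) (λ ())
... | B₀ , _ , B₀-max with em {Ind M (B₀ +ₛ f)}
... | no B₀+f-dep =
  let D-circuit = fundamentalCircuit-circuit em M em₁ (independent B₀-max) B₀+f-dep
      S , S∈𝒞 , S⊆D , f∈S , f-sign = signedSupport-matching circSig D-circuit (inj₁ refl) C f∈C
  in S , S∈𝒞 , f∈S , f-sign , λ _ → D⊆Allowed ∘ S⊆D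
  where
  open OrthOriented oo
  D⊆Allowed : FundamentalCircuit M B₀ f ⊆ Allowed C X Cx
  D⊆Allowed (inj₁ refl) = inj₁ f∈C , λ f∈X → f∉sep f f∈X (x∈sep f f∈X)
  D⊆Allowed (inj₂ (e∈B₀ , _)) = proj₁ (within B₀-max e∈B₀)
... | yes B₀+f-ind =
  let B , B₀+f⊆B , B-base = extendToBase M B₀+f-ind
      K-cocircuit = fundamentalCocircuit-cocircuit em M em₁ B-base (B₀+f⊆B (inj₂ refl))
      K , K∈𝒞* , K⊆ , ⊆K = signedSupport cocircSig K-cocircuit
  in ⊥-elim (¬Orthogonal-C-K em C X Cx x∈Cx Cx∩X⊆x x∈sep f∈C f∉sep K (⊆K (inj₁ refl))
               (λ k → fundamentalCocircuit∩⊆ em M {S = Allowed C X Cx} B₀-max B₀+f⊆B (K⊆ k))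
               (λ x p → orth (Cx x p) K (Cx∈𝒞 x p) K∈𝒞*) (orth C K C∈𝒞 K∈𝒞*))
  where open OrthOriented oo
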